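{- Let $n\ge 2$ and $k\ge1$ be integers and $1\le a<b\le n$, and let $(a\,b)\in\mathfrak{S}_n$ be the transposition. Then the number of cycles of length two of $(a\,b)^{\odot k}$ is $$C_2\big((a\,b)^{\odot k}\big)=\frac12\left(\binom{n+k-1}{n-1}-\sum_{\ell=0}^{\lfloor k/2\rfloor}\binom{k-2\ell+n-3}{k-2\ell}\right).$$
   Context: For positive integers $n,k$, let $\mathcal{C}_{n,k}$ be the set of weakly increasing $k$-tuples $(i_1\le\cdots\le i_k)$ with entries in $[n]$ (equivalently, $k$-element multisets from $[n]$). For $\sigma\in\mathfrak{S}_n$, the $k$-th symmetric tensor power $\sigma^{\odot k}$ is the permutation of $\mathcal{C}_{n,k}$ sending $(i_1,\dots,i_k)$ to the weakly increasing rearrangement of $(\sigma(i_1),\dots,\sigma(i_k))$ (equivalently, the permutation given by the $k$-th symmetric tensor power of the permutation matrix of $\sigma$). For a permutation $\tau$, $C_s(\tau)$ denotes the number of cycles of length $s$ in its cycle decomposition. Binomial coefficients $\binom{a}{b}$ with integer $a$ and nonnegative integer $b$ are $a(a-1)\cdots(a-b+1)/b!$ (so $\binom{ -1}{0}=1$, $\binom{m-1}{m}=0$ for $m\ge1$). -}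

module Defs where

open import Data.Nat as ℕ using (ℕ; zero; suc; _∸_; NonZero; _!)
open import Data.Nat.Properties using (_!≢0)
open import Data.Integer as ℤ using (ℤ; +_)
open import Data.Rational as ℚ using (ℚ)
open import Data.Fin as Fin using (Fin)
open import Data.Fin.Properties using (_≟_)
open import Data.Fin.Permutation using (Permutation′; _⟨$⟩ʳ_)
open import Data.Vec as Vec using (Vec; []; _∷_)
import Data.Vec.Properties as VecP
open import Data.List as List using (List; []; _∷_; concatMap; allFin; upTo; filter; length)
open import Data.Product using (_×_; _,_)
open import Relation.Nullary using (Dec; yes; no; ¬_; _×-dec_)
open import Relation.Nullary.Decidable using (¬?)
open import Relation.Binary.PropositionalEquality using (_≡_)
open import Relation.Unary using (Pred; Decidable)
open import Data.List.Relation.Unary.All using (All; all?)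
open import Data.Nat.DivMod using (_/_)

data Sorted {n : ℕ} : {k : ℕ} → Vec (Fin n) k → Set where
  []  : Sorted []
  [x] : (x : Fin n) → Sorted (x ∷ [])
  _∷_ : {x y : Fin n} {k : ℕ} {v : Vec (Fin n) k} →
        x Fin.≤ y → Sorted (y ∷ v) → Sorted (x ∷ y ∷ v)

sorted? : {n k : ℕ} (v : Vec (Fin n) k) → Dec (Sorted v)
sorted? [] = yes []
sorted? (x ∷ []) = yes ([x] x)
sorted? (x ∷ y ∷ v) with x Fin.≤? y | sorted? (y ∷ v)
... | yes p | yes q = yes (p ∷ q)
... | no ¬p | _     = no λ { (p ∷ _) → ¬p p }
... | yes _ | no ¬q = no λ { (_ ∷ q) → ¬q q }

allVecs : (n k : ℕ) → List (Vec (Fin n) k)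
allVecs n zero    = [] ∷ []
allVecs n (suc k) = concatMap (λ x → List.map (x ∷_) (allVecs n k)) (allFin n)

C : (n k : ℕ) → List (Vec (Fin n) k)
C n k = filter sorted? (allVecs n k)

insert : {n k : ℕ} → Fin n → Vec (Fin n) k → Vec (Fin n) (suc k)
insert x [] = x ∷ []
insert x (y ∷ v) with x Fin.≤? y
... | yes _ = x ∷ y ∷ v
... | no  _ = y ∷ insert x v

sort : {n k : ℕ} → Vec (Fin n) k → Vec (Fin n) k
sort []      = []
sort (x ∷ v) = insert x (sort v)

symPow : {n : ℕ} → Permutation′ n → (k : ℕ) → Vec (Fin n) k → Vec (Fin n) k
symPow σ k v = sort (Vec.map (σ ⟨$⟩ʳ_) v)

-- number of cycles of length s of a permutation f of a finite set
-- enumerated (without repetition) by the list xs: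
--   C_s(f) = #{x | f^s x = x, f^j x ≠ x for 0<j<s} / s

iter : {A : Set} → (A → A) → ℕ → A → A
iter f zero    x = x
iter f (suc j) x = f (iter f j x)

module _ {A : Set} (_≟A_ : (x y : A) → Dec (x ≡ y)) where

  noSmallerPeriod? : (f : A → A) (x : A) (j : ℕ) → Dec (All (λ i → ¬ (iter f i x ≡ x)) (List.drop 1 (upTo j)))
  noSmallerPeriod? f x j = all? (λ i → ¬? (iter f i x ≟A x)) _

  exactPeriod? : (f : A → A) (s : ℕ) (x : A) → Dec _
  exactPeriod? f s x = (iter f s x ≟A x) ×-dec noSmallerPeriod? f x s

  numCycles : (xs : List A) (f : A → A) (s : ℕ) .{{_ : NonZero s}} → ℕ
  numCycles xs f s = length (filter (exactPeriod? f s) xs) / s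

_≟V_ : {n k : ℕ} (u v : Vec (Fin n) k) → Dec (u ≡ v)
_≟V_ = VecP.≡-dec _≟_

CsSymPow : {n : ℕ} (σ : Permutation′ n) (k s : ℕ) .{{_ : NonZero s}} → ℕ
CsSymPow {n} σ k s = numCycles _≟V_ (C n k) (symPow σ k) s

falling : ℤ → ℕ → ℤ
falling a zero    = + 1
falling a (suc b) = falling a b ℤ.* (a ℤ.- + b)

binom : ℤ → ℕ → ℚ
binom a b = ℚ._/_ (falling a b) (b !) {{b !≢0}}

sumTo : ℕ → (ℕ → ℚ) → ℚ
sumTo m f = List.foldr ℚ._+_ ℚ.0ℚ (List.map f (upTo (suc m)))

{-# OPTIONS --safe #-}
-- The transposition τ = (a b) acts on a multiset by exchanging the multiplicities of a and b,
-- so τ^{⊙k} is an involution whose fixed points are the multisets with m_a = m_b, and every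
-- other multiset lies in a 2-cycle.  Applying τ also exchanges the multisets with m_a < m_b and
-- those with m_a > m_b, so there are 2G non-fixed points and C₂ = G, where G counts m_a < m_b.
-- Multisets are counted through their multiplicity vectors: all of them are the weak
-- compositions of k into n parts, C(n+k-1, n-1) of them, and after conjugating (a, b) to
-- (1, 2), those with m_a = m_b = ℓ are the weak compositions of k - 2ℓ into n - 2 parts.
module Submission where

open import Defs
open import Data.Nat using (ℕ; _≤_; _∸_; _+_; _*_)
open import Data.Nat.DivMod using (_/_)
open import Data.Integer using (+_) renaming (_-_ to _-ℤ_)
open import Data.Rational using (ℚ; ½; _-_) renaming (_*_ to _*ℚ_; _/_ to _/ℚ_)
open import Data.Fin using (Fin) renaming (_<_ to _<F_)
open import Data.Fin.Permutation using (transpose)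
open import Relation.Binary.PropositionalEquality using (_≡_)

open import Level using (0ℓ)
open import Data.Nat using (zero; suc; _<_; z≤n; s≤s; NonZero; _!; _≤?_; _<?_)
import Data.Nat.Properties as ℕ
open import Data.Nat.Properties
  using ( +-suc; +-comm; +-identityʳ; *-suc; *-comm; *-zeroʳ; suc-injective; m+n≡0⇒m≡0; m+n≡0⇒n≡0
        ; m≤m+n; m+n∸m≡n; m≤n⇒m∸n≡0; ≤-reflexive; <⇒≤; ≰⇒>; <-irrefl; <-asym; <-≤-trans; <⇒≢; >⇒≢
        ; 0≢1+n; _!≢0 )
open import Data.Nat.DivMod using (m/n*n≡m; m*n/n≡m; m/n≡1+[m∸n]/n)
open import Data.Nat.Combinatorics
  using (_P_; nCk≡nPk/k!; nPk≡n!/[n∸k]!; nCk≡nC[n∸k]; nCn≡1; nCk+nC[k+1]≡[n+1]C[k+1]; k>n⇒nCk≡0)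
  renaming (_C_ to _choose_)
open import Data.Nat.Combinatorics.Base using (_P′_)
open import Data.Nat.Combinatorics.Specification using (nP′k≡n!/[n∸k]!; k!∣nP′k)
import Data.Integer as ℤ
import Data.Integer.Properties as ℤ
open import Data.Integer.Properties using (pos-+; pos-*; m-n≡m⊖n; ⊖-≥)
import Data.Rational as ℚ
import Data.Rational.Properties as ℚ
open import Data.Rational.Properties using (toℚᵘ-injective; toℚᵘ-fromℚᵘ; toℚᵘ-homo-+; fromℚᵘ-cong)
open import Data.Rational.Solver renaming (module +-*-Solver to ℚ-Solver)
open import Data.Rational.Unnormalised as ℚᵘ using (mkℚᵘ; *≡*)
import Data.Rational.Unnormalised.Properties as ℚᵘ
import Data.Fin as Fin
open import Data.Fin.Properties using (_≟_; <-cmp)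
open import Data.Fin.Permutation using (Permutation′; _⟨$⟩ʳ_; _⟨$⟩ˡ_; inverseˡ; inverseʳ; flip)
import Data.Fin.Permutation.Components as PC
open import Data.Vec as Vec using (Vec; []; _∷_; lookup; replicate; updateAt)
open import Data.Vec.Properties
  using ( lookup∘updateAt; lookup∘updateAt′; updateAt-commutes; lookup-replicate
        ; ∷-injectiveˡ; ∷-injectiveʳ; tabulate∘lookup; tabulate-cong )
open import Data.List as List
  using (List; []; _∷_; length; filter; map; _++_; concatMap; cartesianProductWith; allFin; applyUpTo; upTo)
open import Data.List.Properties using (length-map; length-++; map-cong)
open import Data.List.Membership.Propositional using (_∈_)
open import Data.List.Membership.Propositional.Properties
  using (∈-map⁺; ∈-map⁻; ∈-filter⁺; ∈-filter⁻; ∈-++⁺ˡ; ∈-++⁺ʳ; ∈-++⁻; ∈-cartesianProductWith⁺; ∈-allFin)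
open import Data.List.Membership.Propositional.Properties.WithK using (unique∧set⇒bag)
open import Data.List.Relation.Unary.Any using (here; there)
open import Data.List.Relation.Unary.All as All using (All; []; _∷_)
import Data.List.Relation.Unary.All.Properties as All
open import Data.List.Relation.Unary.AllPairs using ([]; _∷_)
open import Data.List.Relation.Unary.Unique.Propositional using (Unique)
import Data.List.Relation.Unary.Unique.Propositional.Properties as Unique
open import Data.List.Relation.Binary.BagAndSetEquality using (∼bag⇒↭)
open import Data.List.Relation.Binary.Permutation.Propositional.Properties using (↭-length)
open import Data.Product using (_×_; _,_; proj₁; proj₂; ∃-syntax)
open import Data.Sum as Sum using (_⊎_; inj₁; inj₂; [_,_]′)
open import Function using (_∘_; _⇔_; mk⇔; Equivalence)
open import Function.Construct.Composition using (_⇔-∘_)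
open import Relation.Nullary using (Dec; yes; no; ¬_; contradiction)
open import Relation.Nullary.Decidable using (dec-true; dec-false; toSum)
open import Relation.Unary using (Pred; Decidable)
open import Relation.Unary.Properties using (U?)
open import Relation.Binary.Definitions using (tri<; tri≈; tri>) renaming (Decidable to Decidable₂)
open import Relation.Binary.PropositionalEquality
  using (_≢_; _≗_; refl; sym; trans; cong; cong₂; subst; subst₂; module ≡-Reasoning)

private
  variable
    A B : Set
    n k : ℕ

open Equivalence using (to; from)

≢⇔<⊎> : {x y : ℕ} → x ≢ y ⇔ (x < y ⊎ y < x)
≢⇔<⊎> {x} {y} = mk⇔ split [ <⇒≢ , >⇒≢ ]′
  where
  split : x ≢ y → x < y ⊎ y < x
  split x≢y with ℕ.<-cmp x y
  ... | tri< x<y _ _ = inj₁ x<y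
  ... | tri≈ _ x≡y _ = contradiction x≡y x≢y
  ... | tri> _ _ y<x = inj₂ y<x

unique-map⁺ : (f : A → B) {xs : List A} → Unique xs →
              (∀ {x y} → x ∈ xs → y ∈ xs → f x ≡ f y → x ≡ y) → Unique (map f xs)
unique-map⁺ f []           inj = []
unique-map⁺ f (x∉xs ∷ xs!) inj =
  All.map⁺ (All.tabulate λ y∈xs fx≡fy → All.lookup x∉xs y∈xs (inj (here refl) (there y∈xs) fx≡fy))
  ∷ unique-map⁺ f xs! (λ x∈xs y∈xs → inj (there x∈xs) (there y∈xs))

length-≡-by-bijection : {xs : List A} {ys : List B} (f : A → B) → Unique xs → Unique ys →
                        (∀ {x y} → x ∈ xs → y ∈ xs → f x ≡ f y → x ≡ y) →
                        (∀ {x} → x ∈ xs → f x ∈ ys) →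
                        (∀ {y} → y ∈ ys → ∃[ x ] x ∈ xs × f x ≡ y) →
                        length xs ≡ length ys
length-≡-by-bijection {xs = xs} {ys} f xs! ys! inj into onto =
  trans (sym (length-map f xs))
        (↭-length (∼bag⇒↭ (unique∧set⇒bag (unique-map⁺ f xs! inj) ys! (mk⇔ image⊆ys ys⊆image))))
  where
  image⊆ys : ∀ {y} → y ∈ map f xs → y ∈ ys
  image⊆ys y∈ with ∈-map⁻ f y∈
  ... | x , x∈xs , refl = into x∈xs
  ys⊆image : ∀ {y} → y ∈ ys → y ∈ map f xs
  ys⊆image y∈ys with onto y∈ys
  ... | x , x∈xs , refl = ∈-map⁺ f x∈xs

length-filter-⊎ : {P Q R : Pred A 0ℓ} (P? : Decidable P) (Q? : Decidable Q) (R? : Decidable R) (xs : List A) →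
                  (∀ {x} → x ∈ xs → P x ⇔ (Q x ⊎ R x)) → (∀ {x} → x ∈ xs → Q x → ¬ R x) →
                  length (filter P? xs) ≡ length (filter Q? xs) + length (filter R? xs)
length-filter-⊎ P? Q? R? [] _ _ = refl
length-filter-⊎ P? Q? R? (x ∷ xs) P⇔Q⊎R Q⇒¬R
  with P? x | Q? x | R? x | length-filter-⊎ P? Q? R? xs (P⇔Q⊎R ∘ there) (Q⇒¬R ∘ there)
... | _     | yes q | yes r | _  = contradiction r (Q⇒¬R (here refl) q)
... | yes _ | yes _ | no _  | ih = cong suc ih
... | yes _ | no _  | yes _ | ih = trans (cong suc ih) (sym (+-suc _ _))
... | yes p | no ¬q | no ¬r | _  = contradiction (to (P⇔Q⊎R (here refl)) p) [ ¬q , ¬r ]′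
... | no ¬p | yes q | _     | _  = contradiction (from (P⇔Q⊎R (here refl)) (inj₁ q)) ¬p
... | no ¬p | no _  | yes r | _  = contradiction (from (P⇔Q⊎R (here refl)) (inj₂ r)) ¬p
... | no _  | no _  | no _  | ih = ih

-- Sorted vectors and their multiplicities

sorted-tail : {x : Fin n} {v : Vec (Fin n) k} → Sorted (x ∷ v) → Sorted v
sorted-tail ([x] _)  = []
sorted-tail (_ ∷ xv) = xv

sorted-∷-insert : (x y : Fin n) (v : Vec (Fin n) k) → Sorted (y ∷ v) → y Fin.≤ x → Sorted (y ∷ insert x v)
sorted-∷-insert x y []      _          y≤x = y≤x ∷ [x] x
sorted-∷-insert x y (z ∷ v) (y≤z ∷ zv) y≤x with x Fin.≤? z
... | yes x≤z = y≤x ∷ (x≤z ∷ zv)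
... | no  x≰z = y≤z ∷ sorted-∷-insert x z v zv (<⇒≤ (≰⇒> x≰z))

sorted-insert : (x : Fin n) (v : Vec (Fin n) k) → Sorted v → Sorted (insert x v)
sorted-insert x []      _  = [x] x
sorted-insert x (z ∷ v) zv with x Fin.≤? z
... | yes x≤z = x≤z ∷ zv
... | no  x≰z = sorted-∷-insert x z v zv (<⇒≤ (≰⇒> x≰z))

sorted-sort : (v : Vec (Fin n) k) → Sorted (sort v)
sorted-sort []      = []
sorted-sort (x ∷ v) = sorted-insert x (sort v) (sorted-sort v)

mult : Vec (Fin n) k → Vec ℕ n
mult {n} []  = replicate n 0
mult (x ∷ v) = updateAt (mult v) x suc

multiplicity : Fin n → Vec (Fin n) k → ℕ
multiplicity c v = lookup (mult v) c

multiplicity-∷-≡ : (x : Fin n) (v : Vec (Fin n) k) → multiplicity x (x ∷ v) ≡ suc (multiplicity x v)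
multiplicity-∷-≡ x v = lookup∘updateAt x (mult v)

multiplicity-∷-≢ : {x c : Fin n} (v : Vec (Fin n) k) → x ≢ c → multiplicity c (x ∷ v) ≡ multiplicity c v
multiplicity-∷-≢ v x≢c = lookup∘updateAt′ _ _ (x≢c ∘ sym) (mult v)

updateAt-suc-comm : (x y : Fin n) (m : Vec ℕ n) → updateAt (updateAt m y suc) x suc ≡ updateAt (updateAt m x suc) y suc
updateAt-suc-comm x y m with x ≟ y
... | yes refl = refl
... | no  x≢y  = updateAt-commutes x y x≢y m

updateAt-suc-injective : (x : Fin n) {m m′ : Vec ℕ n} → updateAt m x suc ≡ updateAt m′ x suc → m ≡ m′
updateAt-suc-injective Fin.zero    {_ ∷ _} {_ ∷ _} eq = cong₂ _∷_ (suc-injective (∷-injectiveˡ eq)) (∷-injectiveʳ eq)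
updateAt-suc-injective (Fin.suc x) {_ ∷ _} {_ ∷ _} eq = cong₂ _∷_ (∷-injectiveˡ eq) (updateAt-suc-injective x (∷-injectiveʳ eq))

mult-insert : (x : Fin n) (v : Vec (Fin n) k) → mult (insert x v) ≡ mult (x ∷ v)
mult-insert x []      = refl
mult-insert x (y ∷ v) with x Fin.≤? y
... | yes _ = refl
... | no  _ = trans (cong (λ m → updateAt m y suc) (mult-insert x v)) (updateAt-suc-comm y x (mult v))

mult-sort : (v : Vec (Fin n) k) → mult (sort v) ≡ mult v
mult-sort []      = refl
mult-sort (x ∷ v) = trans (mult-insert x (sort v)) (cong (λ m → updateAt m x suc) (mult-sort v))

≗-lookup⇒≡ : (u w : Vec A n) → lookup u ≗ lookup w → u ≡ w
≗-lookup⇒≡ u w eq = trans (sym (tabulate∘lookup u)) (trans (tabulate-cong eq) (tabulate∘lookup w))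

multiplicity-below-head : {x y : Fin n} (v : Vec (Fin n) k) → Sorted (y ∷ v) → x <F y → multiplicity x (y ∷ v) ≡ 0
multiplicity-below-head {x = x} {y} v yv x<y = trans (multiplicity-∷-≢ v y≢x) (below v yv)
  where
  y≢x : y ≢ x
  y≢x refl = <-irrefl refl x<y
  below : (v : Vec (Fin _) _) → Sorted (y ∷ v) → multiplicity x v ≡ 0
  below []      _          = lookup-replicate x 0
  below (z ∷ v) (y≤z ∷ zv) = multiplicity-below-head v zv (<-≤-trans x<y y≤z)

head-≮-sorted-head : {x y : Fin n} {u w : Vec (Fin n) k} → Sorted (y ∷ w) → mult (x ∷ u) ≡ mult (y ∷ w) → ¬ (x <F y)
head-≮-sorted-head {x = x} {y} {u} {w} yw eq x<y = 0≢1+n (begin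
  0                        ≡⟨ multiplicity-below-head w yw x<y ⟨
  multiplicity x (y ∷ w)   ≡⟨ cong (λ m → lookup m x) eq ⟨
  multiplicity x (x ∷ u)   ≡⟨ multiplicity-∷-≡ x u ⟩
  suc (multiplicity x u)   ∎)
  where open ≡-Reasoning

sorted-mult-injective : {u w : Vec (Fin n) k} → Sorted u → Sorted w → mult u ≡ mult w → u ≡ w
sorted-mult-injective {u = []}    {[]}    _  _  _  = refl
sorted-mult-injective {u = x ∷ u} {y ∷ w} xu yw eq with <-cmp x y
... | tri< x<y _ _  = contradiction x<y (head-≮-sorted-head {u = u} yw eq)
... | tri> _ _ y<x  = contradiction y<x (head-≮-sorted-head {u = w} xu (sym eq))
... | tri≈ _ refl _ = cong (x ∷_) (sorted-mult-injective (sorted-tail xu) (sorted-tail yw) (updateAt-suc-injective x eq))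

sorted-multiplicity-injective : {u w : Vec (Fin n) k} → Sorted u → Sorted w →
                                (∀ c → multiplicity c u ≡ multiplicity c w) → u ≡ w
sorted-multiplicity-injective su sw eq = sorted-mult-injective su sw (≗-lookup⇒≡ _ _ eq)

sum-updateAt-suc : (x : Fin n) (m : Vec ℕ n) → Vec.sum (updateAt m x suc) ≡ suc (Vec.sum m)
sum-updateAt-suc Fin.zero    (j ∷ m) = refl
sum-updateAt-suc (Fin.suc x) (j ∷ m) = trans (cong (λ s → j + s) (sum-updateAt-suc x m)) (+-suc j (Vec.sum m))

sum-replicate-0 : (n : ℕ) → Vec.sum (replicate n 0) ≡ 0
sum-replicate-0 zero    = refl
sum-replicate-0 (suc n) = sum-replicate-0 n

sum-mult : (v : Vec (Fin n) k) → Vec.sum (mult v) ≡ k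
sum-mult {n} []  = sum-replicate-0 n
sum-mult (x ∷ v) = trans (sum-updateAt-suc x (mult v)) (cong suc (sum-mult v))

expand : (m : Vec ℕ n) → Vec (Fin n) (Vec.sum m)
expand []      = []
expand (j ∷ m) = replicate j Fin.zero Vec.++ Vec.map Fin.suc (expand m)

mult-map-suc : (v : Vec (Fin n) k) → mult (Vec.map Fin.suc v) ≡ 0 ∷ mult v
mult-map-suc []      = refl
mult-map-suc (x ∷ v) = cong (λ m → updateAt m (Fin.suc x) suc) (mult-map-suc v)

mult-zeros-++-map-suc : (j : ℕ) (v : Vec (Fin n) k) → mult (replicate j Fin.zero Vec.++ Vec.map Fin.suc v) ≡ j ∷ mult v
mult-zeros-++-map-suc zero    v = mult-map-suc v
mult-zeros-++-map-suc (suc j) v = cong (λ m → updateAt m Fin.zero suc) (mult-zeros-++-map-suc j v)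

mult-expand : (m : Vec ℕ n) → mult (expand m) ≡ m
mult-expand []      = refl
mult-expand (j ∷ m) = trans (mult-zeros-++-map-suc j (expand m)) (cong (j ∷_) (mult-expand m))

mult-surjective : (m : Vec ℕ n) → Vec.sum m ≡ k → ∃[ v ] Sorted {n} {k} v × mult v ≡ m
mult-surjective m refl = sort (expand m) , sorted-sort (expand m) , trans (mult-sort (expand m)) (mult-expand m)

-- The action of permutations on C n k

transpose-matchˡ : (i j : Fin n) → PC.transpose i j i ≡ j
transpose-matchˡ i j rewrite dec-true (i ≟ i) refl = refl

transpose-matchʳ : (i j : Fin n) → PC.transpose i j j ≡ i
transpose-matchʳ i j with j ≟ i
... | yes j≡i = j≡i
... | no  _   rewrite dec-true (j ≟ j) refl = refl

transpose-other : {i j c : Fin n} → c ≢ i → c ≢ j → PC.transpose i j c ≡ c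
transpose-other {i = i} {j} {c} c≢i c≢j rewrite dec-false (c ≟ i) c≢i | dec-false (c ≟ j) c≢j = refl

transpose-involutive : (i j c : Fin n) → PC.transpose i j (PC.transpose i j c) ≡ c
transpose-involutive i j c = cases c (c ≟ i) (c ≟ j)
  where
  cases : ∀ c → Dec (c ≡ i) → Dec (c ≡ j) → PC.transpose i j (PC.transpose i j c) ≡ c
  cases _ (yes refl) _          = trans (cong (PC.transpose i j) (transpose-matchˡ i j)) (transpose-matchʳ i j)
  cases _ (no _)     (yes refl) = trans (cong (PC.transpose i j) (transpose-matchʳ i j)) (transpose-matchˡ i j)
  cases c (no c≢i)   (no c≢j)   = trans (cong (PC.transpose i j) (transpose-other c≢i c≢j)) (transpose-other c≢i c≢j)

transpose-invariant : (f : Fin n → A) {i j : Fin n} → f i ≡ f j → (c : Fin n) → f (PC.transpose i j c) ≡ f c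
transpose-invariant f {i} {j} fi≡fj c = cases c (c ≟ i) (c ≟ j)
  where
  cases : ∀ c → Dec (c ≡ i) → Dec (c ≡ j) → f (PC.transpose i j c) ≡ f c
  cases _ (yes refl) _          = trans (cong f (transpose-matchˡ i j)) (sym fi≡fj)
  cases _ (no _)     (yes refl) = trans (cong f (transpose-matchʳ i j)) fi≡fj
  cases c (no c≢i)   (no c≢j)   = cong f (transpose-other c≢i c≢j)

multiplicity-map : (π : Permutation′ n) (v : Vec (Fin n) k) (c : Fin n) →
                   multiplicity c (Vec.map (π ⟨$⟩ʳ_) v) ≡ multiplicity (π ⟨$⟩ˡ c) v
multiplicity-map π []      c = trans (lookup-replicate c 0) (sym (lookup-replicate (π ⟨$⟩ˡ c) 0))
multiplicity-map π (x ∷ v) c with π ⟨$⟩ʳ x ≟ c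
... | yes refl = begin
  multiplicity (π ⟨$⟩ʳ x) ((π ⟨$⟩ʳ x) ∷ πv)  ≡⟨ multiplicity-∷-≡ (π ⟨$⟩ʳ x) πv ⟩
  suc (multiplicity (π ⟨$⟩ʳ x) πv)           ≡⟨ cong suc (multiplicity-map π v _) ⟩
  suc (multiplicity (π ⟨$⟩ˡ (π ⟨$⟩ʳ x)) v)   ≡⟨ cong (λ y → suc (multiplicity y v)) (inverseˡ π) ⟩
  suc (multiplicity x v)                     ≡⟨ multiplicity-∷-≡ x v ⟨
  multiplicity x (x ∷ v)                     ≡⟨ cong (λ y → multiplicity y (x ∷ v)) (inverseˡ π) ⟨
  multiplicity (π ⟨$⟩ˡ (π ⟨$⟩ʳ x)) (x ∷ v)   ∎
  where
  open ≡-Reasoning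
  πv = Vec.map (π ⟨$⟩ʳ_) v
... | no πx≢c = trans (multiplicity-∷-≢ (Vec.map (π ⟨$⟩ʳ_) v) πx≢c)
                      (trans (multiplicity-map π v c) (sym (multiplicity-∷-≢ v x≢π⁻¹c)))
  where
  x≢π⁻¹c : x ≢ π ⟨$⟩ˡ c
  x≢π⁻¹c refl = πx≢c (inverseʳ π)

multiplicity-symPow : (π : Permutation′ n) (v : Vec (Fin n) k) (c : Fin n) →
                      multiplicity c (symPow π k v) ≡ multiplicity (π ⟨$⟩ˡ c) v
multiplicity-symPow π v c = trans (cong (λ m → lookup m c) (mult-sort (Vec.map (π ⟨$⟩ʳ_) v))) (multiplicity-map π v c)

symPow-sorted : (π : Permutation′ n) (v : Vec (Fin n) k) → Sorted (symPow π k v)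
symPow-sorted π v = sorted-sort (Vec.map (π ⟨$⟩ʳ_) v)

symPow-inverseʳ : (π : Permutation′ n) {w : Vec (Fin n) k} → Sorted w → symPow π k (symPow (flip π) k w) ≡ w
symPow-inverseʳ π {w} sw = sorted-multiplicity-injective (symPow-sorted π (symPow (flip π) _ w)) sw λ c → begin
  multiplicity c (symPow π _ (symPow (flip π) _ w)) ≡⟨ multiplicity-symPow π (symPow (flip π) _ w) c ⟩
  multiplicity (π ⟨$⟩ˡ c) (symPow (flip π) _ w)     ≡⟨ multiplicity-symPow (flip π) w _ ⟩
  multiplicity (π ⟨$⟩ʳ (π ⟨$⟩ˡ c)) w                ≡⟨ cong (λ y → multiplicity y w) (inverseʳ π) ⟩
  multiplicity c w                                  ∎
  where open ≡-Reasoning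

multiplicity-symPow-image : (π : Permutation′ n) (v : Vec (Fin n) k) (c : Fin n) →
                            multiplicity (π ⟨$⟩ʳ c) (symPow π k v) ≡ multiplicity c v
multiplicity-symPow-image π v c = trans (multiplicity-symPow π v (π ⟨$⟩ʳ c)) (cong (λ y → multiplicity y v) (inverseˡ π))

symPow-injective : (π : Permutation′ n) {u v : Vec (Fin n) k} → Sorted u → Sorted v →
                   symPow π k u ≡ symPow π k v → u ≡ v
symPow-injective π {u} {v} su sv eq = sorted-multiplicity-injective su sv λ c → begin
  multiplicity c u                        ≡⟨ multiplicity-symPow-image π u c ⟨
  multiplicity (π ⟨$⟩ʳ c) (symPow π _ u)  ≡⟨ cong (multiplicity (π ⟨$⟩ʳ c)) eq ⟩
  multiplicity (π ⟨$⟩ʳ c) (symPow π _ v)  ≡⟨ multiplicity-symPow-image π v c ⟩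
  multiplicity c v                        ∎
  where open ≡-Reasoning

symPow-involutive : (π : Permutation′ n) → (∀ c → π ⟨$⟩ˡ (π ⟨$⟩ˡ c) ≡ c) →
                    {v : Vec (Fin n) k} → Sorted v → symPow π k (symPow π k v) ≡ v
symPow-involutive π π²≗id {v} sv = sorted-multiplicity-injective (symPow-sorted π (symPow π _ v)) sv λ c → begin
  multiplicity c (symPow π _ (symPow π _ v))  ≡⟨ multiplicity-symPow π (symPow π _ v) c ⟩
  multiplicity (π ⟨$⟩ˡ c) (symPow π _ v)      ≡⟨ multiplicity-symPow π v (π ⟨$⟩ˡ c) ⟩
  multiplicity (π ⟨$⟩ˡ (π ⟨$⟩ˡ c)) v          ≡⟨ cong (λ y → multiplicity y v) (π²≗id c) ⟩
  multiplicity c v                            ∎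
  where open ≡-Reasoning

concatMap-map≡cartesianProductWith : {C : Set} (f : A → B → C) (xs : List A) (ys : List B) →
                                     concatMap (λ x → map (f x) ys) xs ≡ cartesianProductWith f xs ys
concatMap-map≡cartesianProductWith f []       ys = refl
concatMap-map≡cartesianProductWith f (x ∷ xs) ys = cong (map (f x) ys ++_) (concatMap-map≡cartesianProductWith f xs ys)

allVecs-unique : (n k : ℕ) → Unique (allVecs n k)
allVecs-unique n zero    = [] ∷ []
allVecs-unique n (suc k) = subst Unique (sym (concatMap-map≡cartesianProductWith _∷_ (allFin n) (allVecs n k)))
  (Unique.cartesianProductWith⁺ _∷_ (λ eq → ∷-injectiveˡ eq , ∷-injectiveʳ eq) (Unique.allFin⁺ n) (allVecs-unique n k))

∈-allVecs : (v : Vec (Fin n) k) → v ∈ allVecs n k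
∈-allVecs []              = here refl
∈-allVecs {n} {suc k} (x ∷ v) = subst (x ∷ v ∈_) (sym (concatMap-map≡cartesianProductWith _∷_ (allFin n) (allVecs n k)))
  (∈-cartesianProductWith⁺ _∷_ (∈-allFin x) (∈-allVecs v))

C-unique : (n k : ℕ) → Unique (C n k)
C-unique n k = Unique.filter⁺ sorted? (allVecs-unique n k)

∈C⇒sorted : {v : Vec (Fin n) k} → v ∈ C n k → Sorted v
∈C⇒sorted {n} {k} v∈C = proj₂ (∈-filter⁻ sorted? {xs = allVecs n k} v∈C)

sorted⇒∈C : {v : Vec (Fin n) k} → Sorted v → v ∈ C n k
sorted⇒∈C {v = v} sv = ∈-filter⁺ sorted? (∈-allVecs v) sv

∈-filter-C⇒sorted : {P : Pred (Vec (Fin n) k) 0ℓ} (P? : Decidable P) {v : Vec (Fin n) k} → v ∈ filter P? (C n k) → Sorted v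
∈-filter-C⇒sorted {n} {k} P? v∈ = ∈C⇒sorted (proj₁ (∈-filter⁻ P? {xs = C n k} v∈))

count-C-symPow : (π : Permutation′ n) {P Q : Pred (Vec (Fin n) k) 0ℓ} (P? : Decidable P) (Q? : Decidable Q) →
                 (∀ v → P v ⇔ Q (symPow π k v)) → length (filter P? (C n k)) ≡ length (filter Q? (C n k))
count-C-symPow {n} {k} π {Q = Q} P? Q? P⇔Qπ =
  length-≡-by-bijection (symPow π k) (Unique.filter⁺ P? (C-unique n k)) (Unique.filter⁺ Q? (C-unique n k))
    (λ u∈ v∈ → symPow-injective π (∈-filter-C⇒sorted P? u∈) (∈-filter-C⇒sorted P? v∈)) into onto
  where
  into : ∀ {v} → v ∈ filter P? (C n k) → symPow π k v ∈ filter Q? (C n k)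
  into {v} v∈ = ∈-filter⁺ Q? (sorted⇒∈C (symPow-sorted π v)) (to (P⇔Qπ v) (proj₂ (∈-filter⁻ P? {xs = C n k} v∈)))
  onto : ∀ {w} → w ∈ filter Q? (C n k) → ∃[ u ] u ∈ filter P? (C n k) × symPow π k u ≡ w
  onto {w} w∈ = u , ∈-filter⁺ P? (sorted⇒∈C (symPow-sorted (flip π) w)) (from (P⇔Qπ u) (subst Q (sym πu≡w) Qw)) , πu≡w
    where
    u = symPow (flip π) k w
    πu≡w = symPow-inverseʳ π (∈-filter-C⇒sorted Q? w∈)
    Qw = proj₂ (∈-filter⁻ Q? {xs = C n k} w∈)

related? : {R : ℕ → ℕ → Set} → Decidable₂ R → (c d : Fin n) →
           Decidable (λ (v : Vec (Fin n) k) → R (multiplicity c v) (multiplicity d v))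
related? R? c d v = R? (multiplicity c v) (multiplicity d v)

count-related-symPow : (π : Permutation′ n) {R : ℕ → ℕ → Set} (R? : Decidable₂ R) (c d : Fin n) →
  length (filter (related? {k = k} R? c d) (C n k)) ≡ length (filter (related? R? (π ⟨$⟩ʳ c) (π ⟨$⟩ʳ d)) (C n k))
count-related-symPow {k = k} π {R} R? c d =
  count-C-symPow {k = k} π (related? R? c d) (related? R? (π ⟨$⟩ʳ c) (π ⟨$⟩ʳ d)) λ v →
    mk⇔ (subst₂ R (sym (multiplicity-symPow-image π v c)) (sym (multiplicity-symPow-image π v d)))
        (subst₂ R (multiplicity-symPow-image π v c) (multiplicity-symPow-image π v d))

count-C-by-mult : {P : Pred (Vec ℕ n) 0ℓ} (P? : Decidable P) (ms : List (Vec ℕ n)) → Unique ms →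
                  (∀ {m} → m ∈ ms ⇔ (Vec.sum m ≡ k × P m)) → length (filter (P? ∘ mult) (C n k)) ≡ length ms
count-C-by-mult {n} {k} {P} P? ms ms! ms-spec =
  length-≡-by-bijection mult (Unique.filter⁺ (P? ∘ mult) (C-unique n k)) ms!
    (λ u∈ v∈ → sorted-mult-injective (∈-filter-C⇒sorted (P? ∘ mult) u∈) (∈-filter-C⇒sorted (P? ∘ mult) v∈)) into onto
  where
  into : ∀ {v} → v ∈ filter (P? ∘ mult) (C n k) → mult v ∈ ms
  into {v} v∈ = from ms-spec (sum-mult v , proj₂ (∈-filter⁻ (P? ∘ mult) {xs = C n k} v∈))
  onto : ∀ {m} → m ∈ ms → ∃[ v ] v ∈ filter (P? ∘ mult) (C n k) × mult v ≡ m
  onto {m} m∈ with to ms-spec m∈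
  ... | sum≡k , Pm with mult-surjective m sum≡k
  ...   | v , sv , refl = v , ∈-filter⁺ (P? ∘ mult) (sorted⇒∈C sv) Pm , refl

-- Weak compositions

sucHead : Vec ℕ (suc n) → Vec ℕ (suc n)
sucHead (j ∷ m) = suc j ∷ m

compositions : (n k : ℕ) → List (Vec ℕ n)
compositions n       zero    = replicate n 0 ∷ []
compositions zero    (suc k) = []
compositions (suc n) (suc k) = map sucHead (compositions (suc n) k) ++ map (0 ∷_) (compositions n (suc k))

sum≡0⇒replicate-0 : (m : Vec ℕ n) → Vec.sum m ≡ 0 → m ≡ replicate n 0
sum≡0⇒replicate-0 []      _   = refl
sum≡0⇒replicate-0 (j ∷ m) eq = cong₂ _∷_ (m+n≡0⇒m≡0 j eq) (sum≡0⇒replicate-0 m (m+n≡0⇒n≡0 j eq))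

∈-compositions⁻ : (n k : ℕ) {m : Vec ℕ n} → m ∈ compositions n k → Vec.sum m ≡ k
∈-compositions⁻ n       zero    (here refl) = sum-replicate-0 n
∈-compositions⁻ (suc n) (suc k) m∈ with ∈-++⁻ (map sucHead (compositions (suc n) k)) m∈
... | inj₁ m∈₁ with ∈-map⁻ sucHead m∈₁
...   | _ ∷ _ , m′∈ , refl = cong suc (∈-compositions⁻ (suc n) k m′∈)
∈-compositions⁻ (suc n) (suc k) m∈ | inj₂ m∈₂ with ∈-map⁻ (0 ∷_) m∈₂
...   | _ , m′∈ , refl = ∈-compositions⁻ n (suc k) m′∈

∈-compositions⁺ : (n k : ℕ) (m : Vec ℕ n) → Vec.sum m ≡ k → m ∈ compositions n k
∈-compositions⁺ n       zero    m           eq = here (sum≡0⇒replicate-0 m eq)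
∈-compositions⁺ (suc n) (suc k) (zero ∷ m)  eq =
  ∈-++⁺ʳ (map sucHead (compositions (suc n) k)) (∈-map⁺ (0 ∷_) (∈-compositions⁺ n (suc k) m eq))
∈-compositions⁺ (suc n) (suc k) (suc j ∷ m) eq =
  ∈-++⁺ˡ (∈-map⁺ sucHead (∈-compositions⁺ (suc n) k (j ∷ m) (suc-injective eq)))

compositions-unique : (n k : ℕ) → Unique (compositions n k)
compositions-unique n       zero    = [] ∷ []
compositions-unique zero    (suc k) = []
compositions-unique (suc n) (suc k) =
  Unique.++⁺ (Unique.map⁺ sucHead-injective (compositions-unique (suc n) k))
             (Unique.map⁺ ∷-injectiveʳ (compositions-unique n (suc k)))
             disjoint
  where
  sucHead-injective : {u w : Vec ℕ (suc n)} → sucHead u ≡ sucHead w → u ≡ w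
  sucHead-injective {_ ∷ _} {_ ∷ _} refl = refl
  disjoint : ∀ {m} → ¬ (m ∈ map sucHead (compositions (suc n) k) × m ∈ map (0 ∷_) (compositions n (suc k)))
  disjoint (m∈₁ , m∈₂) with ∈-map⁻ sucHead m∈₁ | ∈-map⁻ (0 ∷_) m∈₂
  ... | _ ∷ _ , _ , refl | _ , _ , ()

length-compositions-suc : (n k : ℕ) →
  length (compositions (suc n) (suc k)) ≡ length (compositions (suc n) k) + length (compositions n (suc k))
length-compositions-suc n k = trans (length-++ (map sucHead (compositions (suc n) k)))
  (cong₂ _+_ (length-map sucHead (compositions (suc n) k)) (length-map (0 ∷_) (compositions n (suc k))))

length-compositions : (n k : ℕ) → length (compositions (suc n) k) ≡ (n + k) choose k
length-compositions n       zero    = refl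
length-compositions zero    (suc k) = begin
  length (compositions 1 (suc k))     ≡⟨ length-compositions-suc 0 k ⟩
  length (compositions 1 k) + 0       ≡⟨ +-identityʳ _ ⟩
  length (compositions 1 k)           ≡⟨ length-compositions 0 k ⟩
  k choose k                          ≡⟨ nCn≡1 k ⟩
  1                                   ≡⟨ nCn≡1 (suc k) ⟨
  suc k choose suc k                  ∎
  where open ≡-Reasoning
length-compositions (suc n) (suc k) = begin
  length (compositions (2 + n) (suc k))
    ≡⟨ length-compositions-suc (suc n) k ⟩
  length (compositions (2 + n) k) + length (compositions (suc n) (suc k))
    ≡⟨ cong₂ _+_ (length-compositions (suc n) k) (length-compositions n (suc k)) ⟩
  (suc n + k) choose k + (n + suc k) choose suc k
    ≡⟨ cong (λ m → m choose k + (n + suc k) choose suc k) (+-suc n k) ⟨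
  (n + suc k) choose k + (n + suc k) choose suc k
    ≡⟨ nCk+nC[k+1]≡[n+1]C[k+1] (n + suc k) k ⟩
  (suc n + suc k) choose suc k
    ∎
  where open ≡-Reasoning

count-C : (n k : ℕ) → length (filter U? (C n k)) ≡ length (compositions n k)
count-C n k = count-C-by-mult U? (compositions n k) (compositions-unique n k)
  (mk⇔ (λ m∈ → ∈-compositions⁻ n k m∈ , _) (λ (sum≡k , _) → ∈-compositions⁺ n k _ sum≡k))

zeroHeads : {N : ℕ} → Vec ℕ N → Vec ℕ (2 + N)
zeroHeads w = 0 ∷ 0 ∷ w

sucHeads : {N : ℕ} → Vec ℕ (2 + N) → Vec ℕ (2 + N)
sucHeads (i ∷ j ∷ w) = suc i ∷ suc j ∷ w

twinCompositions : (N K : ℕ) → List (Vec ℕ (2 + N))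
twinCompositions N (suc (suc K)) = map zeroHeads (compositions N (2 + K)) ++ map sucHeads (twinCompositions N K)
twinCompositions N K             = map zeroHeads (compositions N K)

TwinHeaded : {N : ℕ} → Vec ℕ (2 + N) → Set
TwinHeaded m = lookup m Fin.zero ≡ lookup m (Fin.suc Fin.zero)

∈-zero-heads⁻ : (N K : ℕ) {m : Vec ℕ (2 + N)} → m ∈ map zeroHeads (compositions N K) → Vec.sum m ≡ K × TwinHeaded m
∈-zero-heads⁻ N K m∈ with ∈-map⁻ zeroHeads m∈
... | _ , w∈ , refl = ∈-compositions⁻ N K w∈ , refl

zero-heads⊆twinCompositions : (N K : ℕ) {m : Vec ℕ (2 + N)} → m ∈ map zeroHeads (compositions N K) → m ∈ twinCompositions N K
zero-heads⊆twinCompositions N zero          m∈ = m∈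
zero-heads⊆twinCompositions N (suc zero)    m∈ = m∈
zero-heads⊆twinCompositions N (suc (suc K)) m∈ = ∈-++⁺ˡ m∈

∈-twinCompositions⁻ : (N K : ℕ) {m : Vec ℕ (2 + N)} → m ∈ twinCompositions N K → Vec.sum m ≡ K × TwinHeaded m
∈-twinCompositions⁻ N zero          m∈ = ∈-zero-heads⁻ N 0 m∈
∈-twinCompositions⁻ N (suc zero)    m∈ = ∈-zero-heads⁻ N 1 m∈
∈-twinCompositions⁻ N (suc (suc K)) m∈ with ∈-++⁻ (map zeroHeads (compositions N (2 + K))) m∈
... | inj₁ m∈₀ = ∈-zero-heads⁻ N (2 + K) m∈₀
... | inj₂ m∈₊ with ∈-map⁻ sucHeads m∈₊
...   | i ∷ j ∷ w , m′∈ , refl with ∈-twinCompositions⁻ N K m′∈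
...     | sum≡K , i≡j = cong suc (trans (+-suc i (j + Vec.sum w)) (cong suc sum≡K)) , cong suc i≡j

∈-twinCompositions⁺ : (N K : ℕ) (m : Vec ℕ (2 + N)) → Vec.sum m ≡ K → TwinHeaded m → m ∈ twinCompositions N K
∈-twinCompositions⁺ N K (zero ∷ zero ∷ w) sum≡K refl =
  zero-heads⊆twinCompositions N K (∈-map⁺ zeroHeads (∈-compositions⁺ N K w sum≡K))
∈-twinCompositions⁺ N (suc zero) (suc i ∷ suc i ∷ w) sum≡1 refl =
  contradiction (m+n≡0⇒n≡0 i (suc-injective sum≡1)) λ ()
∈-twinCompositions⁺ N (suc (suc K)) (suc i ∷ suc i ∷ w) sum≡2+K refl =
  ∈-++⁺ʳ (map zeroHeads (compositions N (2 + K)))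
         (∈-map⁺ sucHeads (∈-twinCompositions⁺ N K (i ∷ i ∷ w) sum≡K refl))
  where
  sum≡K : i + (i + Vec.sum w) ≡ K
  sum≡K = suc-injective (trans (sym (+-suc i (i + Vec.sum w))) (suc-injective sum≡2+K))

zero-heads-unique : (N K : ℕ) → Unique (map zeroHeads (compositions N K))
zero-heads-unique N K = Unique.map⁺ (∷-injectiveʳ ∘ ∷-injectiveʳ) (compositions-unique N K)

twinCompositions-unique : (N K : ℕ) → Unique (twinCompositions N K)
twinCompositions-unique N zero          = zero-heads-unique N 0
twinCompositions-unique N (suc zero)    = zero-heads-unique N 1
twinCompositions-unique N (suc (suc K)) =
  Unique.++⁺ (zero-heads-unique N (2 + K)) (Unique.map⁺ sucHeads-injective (twinCompositions-unique N K)) disjoint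
  where
  sucHeads-injective : {u w : Vec ℕ (2 + N)} → sucHeads u ≡ sucHeads w → u ≡ w
  sucHeads-injective {_ ∷ _ ∷ _} {_ ∷ _ ∷ _} refl = refl
  disjoint : ∀ {m} → ¬ (m ∈ map zeroHeads (compositions N (2 + K)) × m ∈ map sucHeads (twinCompositions N K))
  disjoint (m∈₀ , m∈₊) with ∈-map⁻ zeroHeads m∈₀ | ∈-map⁻ sucHeads m∈₊
  ... | _ , _ , refl | _ ∷ _ ∷ _ , _ , ()

length-twinCompositions-2+ : (N K : ℕ) →
  length (twinCompositions N (2 + K)) ≡ length (compositions N (2 + K)) + length (twinCompositions N K)
length-twinCompositions-2+ N K = trans (length-++ (map zeroHeads (compositions N (2 + K))))
  (cong₂ _+_ (length-map zeroHeads (compositions N (2 + K))) (length-map sucHeads (twinCompositions N K)))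

count-C-twinHeaded : (N k : ℕ) →
  length (filter (related? ℕ._≟_ Fin.zero (Fin.suc Fin.zero)) (C (2 + N) k)) ≡ length (twinCompositions N k)
count-C-twinHeaded N k = count-C-by-mult (λ m → lookup m Fin.zero ℕ.≟ lookup m (Fin.suc Fin.zero))
  (twinCompositions N k) (twinCompositions-unique N k)
  (mk⇔ (∈-twinCompositions⁻ N k) (λ (sum≡k , twin) → ∈-twinCompositions⁺ N k _ sum≡k twin))

-- Binomial coefficients

fromℕ : ℕ → ℚ
fromℕ c = + c /ℚ 1

fromℕ-+ : (x y : ℕ) → fromℕ (x + y) ≡ fromℕ x ℚ.+ fromℕ y
fromℕ-+ x y = toℚᵘ-injective (begin
  ℚ.toℚᵘ (fromℕ (x + y))                  ≈⟨ toℚᵘ-fromℕ (x + y) ⟩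
  mkℚᵘ (+ (x + y)) 0                      ≈⟨ *≡* cross-multiplied ⟩
  mkℚᵘ (+ x) 0 ℚᵘ.+ mkℚᵘ (+ y) 0          ≈⟨ ℚᵘ.+-cong (toℚᵘ-fromℕ x) (toℚᵘ-fromℕ y) ⟨
  ℚ.toℚᵘ (fromℕ x) ℚᵘ.+ ℚ.toℚᵘ (fromℕ y)  ≈⟨ toℚᵘ-homo-+ (fromℕ x) (fromℕ y) ⟨
  ℚ.toℚᵘ (fromℕ x ℚ.+ fromℕ y)            ∎)
  where
  open ℚᵘ.≃-Reasoning
  toℚᵘ-fromℕ : (z : ℕ) → ℚ.toℚᵘ (fromℕ z) ℚᵘ.≃ mkℚᵘ (+ z) 0
  toℚᵘ-fromℕ z = toℚᵘ-fromℚᵘ (mkℚᵘ (+ z) 0)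
  cross-multiplied : + (x + y) ℤ.* + 1 ≡ (+ x ℤ.* + 1 ℤ.+ + y ℤ.* + 1) ℤ.* + 1
  cross-multiplied = cong (ℤ._* + 1) (trans (pos-+ x y) (sym (cong₂ ℤ._+_ (ℤ.*-identityʳ (+ x)) (ℤ.*-identityʳ (+ y)))))

fromℕ-half-difference : (F G : ℕ) → fromℕ G ≡ ½ *ℚ (fromℕ (F + (G + G)) - fromℕ F)
fromℕ-half-difference F G = begin
  fromℕ G                       ≡⟨ solve 2 (λ f g → con ½ :* ((f :+ (g :+ g)) :- f) := g) refl f g ⟨
  ½ *ℚ ((f ℚ.+ (g ℚ.+ g)) - f)  ≡⟨ cong (λ t → ½ *ℚ (t - f)) (trans (fromℕ-+ F (G + G)) (cong (f ℚ.+_) (fromℕ-+ G G))) ⟨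
  ½ *ℚ (fromℕ (F + (G + G)) - f) ∎
  where
  open ≡-Reasoning
  open ℚ-Solver
  f g : ℚ
  f = fromℕ F
  g = fromℕ G

+[m*n]/n≡fromℕ[m] : (m n : ℕ) .{{_ : NonZero n}} → (+ (m * n)) /ℚ n ≡ fromℕ m
+[m*n]/n≡fromℕ[m] m (suc n) = fromℚᵘ-cong {mkℚᵘ (+ (m * suc n)) n} {mkℚᵘ (+ m) 0}
  (*≡* (trans (ℤ.*-identityʳ (+ (m * suc n))) (pos-* m (suc n))))

k>n⇒nP′k≡0 : {n k : ℕ} → n < k → n P′ k ≡ 0
k>n⇒nP′k≡0 {n} {suc k} (s≤s n≤k) = cong (_* (n P′ k)) (m≤n⇒m∸n≡0 n≤k)

falling-pos : (n k : ℕ) → falling (+ n) k ≡ + (n P′ k)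
falling-pos n zero    = refl
falling-pos n (suc k) = trans (cong (ℤ._* (+ n -ℤ + k)) (falling-pos n k)) (step (k ≤? n))
  where
  step : Dec (k ≤ n) → + (n P′ k) ℤ.* (+ n -ℤ + k) ≡ + ((n ∸ k) * (n P′ k))
  step (yes k≤n) = begin
    + (n P′ k) ℤ.* (+ n -ℤ + k)   ≡⟨ cong (+ (n P′ k) ℤ.*_) (trans (m-n≡m⊖n n k) (⊖-≥ k≤n)) ⟩
    + (n P′ k) ℤ.* + (n ∸ k)      ≡⟨ pos-* (n P′ k) (n ∸ k) ⟨
    + ((n P′ k) * (n ∸ k))        ≡⟨ cong +_ (*-comm (n P′ k) (n ∸ k)) ⟩
    + ((n ∸ k) * (n P′ k))        ∎
    where open ≡-Reasoning
  step (no k≰n) rewrite k>n⇒nP′k≡0 (≰⇒> k≰n) = cong +_ (sym (*-zeroʳ (n ∸ k)))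

nCk*k!≡nP′k : (n k : ℕ) → (n choose k) * k ! ≡ n P′ k
nCk*k!≡nP′k n k with k ≤? n
... | yes k≤n = begin
  (n choose k) * k !  ≡⟨ cong (_* k !) (nCk≡nPk/k! k≤n) ⟩
  (n P k) / k! * k !  ≡⟨ cong (λ m → m / k! * k !) (trans (nPk≡n!/[n∸k]! k≤n) (sym (nP′k≡n!/[n∸k]! k≤n))) ⟩
  (n P′ k) / k! * k ! ≡⟨ m/n*n≡m (k!∣nP′k k≤n) ⟩
  n P′ k              ∎
  where
  open ≡-Reasoning
  instance k!≢0 = k !≢0
  k! = k !
... | no k≰n = trans (cong (_* k !) (k>n⇒nCk≡0 (≰⇒> k≰n))) (sym (k>n⇒nP′k≡0 (≰⇒> k≰n)))

binom-pos : (n k : ℕ) → binom (+ n) k ≡ fromℕ (n choose k)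
binom-pos n k = begin
  (falling (+ n) k /ℚ k !) {{k !≢0}}            ≡⟨ cong (λ i → (i /ℚ k !) {{k !≢0}}) (falling-pos n k) ⟩
  (+ (n P′ k) /ℚ k !) {{k !≢0}}                 ≡⟨ cong (λ m → (+ m /ℚ k !) {{k !≢0}}) (nCk*k!≡nP′k n k) ⟨
  (+ ((n choose k) * k !) /ℚ k !) {{k !≢0}}       ≡⟨ +[m*n]/n≡fromℕ[m] (n choose k) (k !) {{k !≢0}} ⟩
  fromℕ (n choose k)                            ∎
  where open ≡-Reasoning

binom-compositions : (m k : ℕ) → binom (+ (m + k)) k ≡ fromℕ (length (compositions (suc m) k))
binom-compositions m k = trans (binom-pos (m + k) k) (cong fromℕ (sym (length-compositions m k)))

binom-sym-compositions : (m k : ℕ) → binom (+ (m + k)) m ≡ fromℕ (length (compositions (suc m) k))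
binom-sym-compositions m k = begin
  binom (+ (m + k)) m                         ≡⟨ binom-pos (m + k) m ⟩
  fromℕ ((m + k) choose m)                    ≡⟨ cong fromℕ (nCk≡nC[n∸k] (m≤m+n m k)) ⟩
  fromℕ ((m + k) choose (m + k ∸ m))          ≡⟨ cong (λ j → fromℕ ((m + k) choose j)) (m+n∸m≡n m k) ⟩
  fromℕ ((m + k) choose k)                    ≡⟨ binom-pos (m + k) k ⟨
  binom (+ (m + k)) k                         ≡⟨ binom-compositions m k ⟩
  fromℕ (length (compositions (suc m) k))     ∎
  where open ≡-Reasoning

binom-shifted-compositions : (N r : ℕ) → binom (+ (r + (2 + N)) -ℤ + 3) r ≡ fromℕ (length (compositions N r))
binom-shifted-compositions N       zero    = refl
binom-shifted-compositions N       (suc r) = trans (cong (λ j → binom (+ j -ℤ + 3) (suc r)) top≡) (shifted N)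
  where
  top≡ : suc r + (2 + N) ≡ 3 + (r + N)
  top≡ = cong suc (trans (+-suc r (suc N)) (cong suc (+-suc r N)))
  shifted : (N : ℕ) → binom (+ (r + N)) (suc r) ≡ fromℕ (length (compositions N (suc r)))
  shifted zero     = trans (binom-pos (r + 0) (suc r)) (cong fromℕ (k>n⇒nCk≡0 (s≤s (≤-reflexive (+-identityʳ r)))))
  shifted (suc N′) = trans (cong (λ j → binom (+ j) (suc r)) (trans (+-comm r (suc N′)) (sym (+-suc N′ r))))
                           (binom-compositions N′ (suc r))

map-applyUpTo : (h : B → A) (f : ℕ → B) (n : ℕ) → map h (applyUpTo f n) ≡ applyUpTo (h ∘ f) n
map-applyUpTo h f zero    = refl
map-applyUpTo h f (suc n) = cong (h (f 0) ∷_) (map-applyUpTo h (f ∘ suc) n)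

sumTo-suc : (m : ℕ) (h : ℕ → ℚ) → sumTo (suc m) h ≡ h 0 ℚ.+ sumTo m (h ∘ suc)
sumTo-suc m h = cong (λ hs → h 0 ℚ.+ List.foldr ℚ._+_ ℚ.0ℚ hs)
  (trans (map-applyUpTo h suc (suc m)) (sym (map-applyUpTo (h ∘ suc) (λ i → i) (suc m))))

sumTo-cong : (m : ℕ) {h h′ : ℕ → ℚ} → h ≗ h′ → sumTo m h ≡ sumTo m h′
sumTo-cong m h≗h′ = cong (List.foldr ℚ._+_ ℚ.0ℚ) (map-cong h≗h′ (upTo (suc m)))

sumTo-length-compositions : (N K : ℕ) →
  sumTo (K / 2) (λ ℓ → fromℕ (length (compositions N (K ∸ 2 * ℓ)))) ≡ fromℕ (length (twinCompositions N K))
sumTo-length-compositions N zero          = trans (ℚ.+-identityʳ _) (cong fromℕ (sym (length-map zeroHeads (compositions N 0))))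
sumTo-length-compositions N (suc zero)    = trans (ℚ.+-identityʳ _) (cong fromℕ (sym (length-map zeroHeads (compositions N 1))))
sumTo-length-compositions N (suc (suc K)) = begin
  sumTo ((2 + K) / 2) h                               ≡⟨ cong (λ m → sumTo m h) (m/n≡1+[m∸n]/n {2 + K} {2} (s≤s (s≤s z≤n))) ⟩
  sumTo (suc (K / 2)) h                               ≡⟨ sumTo-suc (K / 2) h ⟩
  h 0 ℚ.+ sumTo (K / 2) (h ∘ suc)                     ≡⟨ cong (h 0 ℚ.+_) (sumTo-cong (K / 2) h∘suc≗) ⟩
  h 0 ℚ.+ sumTo (K / 2) (λ ℓ → fromℕ (#c (K ∸ 2 * ℓ))) ≡⟨ cong (h 0 ℚ.+_) (sumTo-length-compositions N K) ⟩
  fromℕ (#c (2 + K)) ℚ.+ fromℕ (#t K)                 ≡⟨ fromℕ-+ (#c (2 + K)) (#t K) ⟨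
  fromℕ (#c (2 + K) + #t K)                           ≡⟨ cong fromℕ (length-twinCompositions-2+ N K) ⟨
  fromℕ (#t (2 + K))                                  ∎
  where
  open ≡-Reasoning
  #c #t : ℕ → ℕ
  #c j = length (compositions N j)
  #t j = length (twinCompositions N j)
  h : ℕ → ℚ
  h ℓ = fromℕ (#c (2 + K ∸ 2 * ℓ))
  h∘suc≗ : ∀ ℓ → h (suc ℓ) ≡ fromℕ (#c (K ∸ 2 * ℓ))
  h∘suc≗ ℓ = cong (λ j → fromℕ (#c (2 + K ∸ j))) (*-suc 2 ℓ)

-- Symmetric powers of a transposition

module _ {k : ℕ} (a b : Fin n) where

  private
    τ : Permutation′ n
    τ = transpose a b

  symPow-transpose-fixed⇒ : {v : Vec (Fin n) k} → symPow τ k v ≡ v → multiplicity a v ≡ multiplicity b v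
  symPow-transpose-fixed⇒ {v} τv≡v = begin
    multiplicity a v                     ≡⟨ cong (multiplicity a) τv≡v ⟨
    multiplicity a (symPow τ k v)        ≡⟨ multiplicity-symPow τ v a ⟩
    multiplicity (PC.transpose b a a) v  ≡⟨ cong (λ c → multiplicity c v) (transpose-matchʳ b a) ⟩
    multiplicity b v                     ∎
    where open ≡-Reasoning

  symPow-transpose-fixed⇐ : {v : Vec (Fin n) k} → Sorted v → multiplicity a v ≡ multiplicity b v → symPow τ k v ≡ v
  symPow-transpose-fixed⇐ {v} sv ma≡mb = sorted-multiplicity-injective (symPow-sorted τ v) sv λ c →
    trans (multiplicity-symPow τ v c) (transpose-invariant (λ c → multiplicity c v) (sym ma≡mb) c)

  -- The left-hand side is what exactPeriod? (symPow τ k) 2 v unfolds to, since drop 1 (upTo 2) = 1 ∷ [].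
  exactPeriod2⇔unbalanced : {v : Vec (Fin n) k} → Sorted v →
    (iter (symPow τ k) 2 v ≡ v × All (λ i → iter (symPow τ k) i v ≢ v) (1 ∷ [])) ⇔ (multiplicity a v ≢ multiplicity b v)
  exactPeriod2⇔unbalanced sv = mk⇔
    (λ { (_ , τv≢v ∷ []) → τv≢v ∘ symPow-transpose-fixed⇐ sv })
    (λ ma≢mb → symPow-involutive τ (transpose-involutive b a) sv , (ma≢mb ∘ symPow-transpose-fixed⇒) ∷ [])

  private
    E? : Decidable _
    E? = exactPeriod? _≟V_ (symPow τ k) 2

  count-exactPeriod2 : length (filter E? (C n k))
                       ≡ length (filter (related? _<?_ a b) (C n k)) + length (filter (related? _<?_ a b) (C n k))
  count-exactPeriod2 = trans
    (length-filter-⊎ E? (related? _<?_ a b) (related? _<?_ b a) (C n k)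
                     (λ v∈ → ≢⇔<⊎> ⇔-∘ exactPeriod2⇔unbalanced (∈C⇒sorted v∈)) (λ _ → <-asym))
    (cong₂ _+_ refl (sym #a<b≡#b<a))
    where
    #a<b≡#b<a : length (filter (related? _<?_ a b) (C n k)) ≡ length (filter (related? _<?_ b a) (C n k))
    #a<b≡#b<a = trans (count-related-symPow {k = k} τ _<?_ a b)
      (cong₂ (λ c d → length (filter (related? _<?_ c d) (C n k))) (transpose-matchˡ a b) (transpose-matchʳ a b))

  count-balanced-⊎-exactPeriod2 : length (filter U? (C n k))
                                  ≡ length (filter (related? ℕ._≟_ a b) (C n k)) + length (filter E? (C n k))
  count-balanced-⊎-exactPeriod2 = length-filter-⊎ U? (related? ℕ._≟_ a b) E? (C n k)
    (λ {v} v∈ → mk⇔ (λ _ → Sum.map₂ (from (exactPeriod2⇔unbalanced (∈C⇒sorted v∈))) (toSum (related? ℕ._≟_ a b v))) _)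
    (λ v∈ ma≡mb period2 → to (exactPeriod2⇔unbalanced (∈C⇒sorted v∈)) period2 ma≡mb)

count-balanced-normalise : {N : ℕ} (a b : Fin (2 + N)) → a <F b →
  length (filter (related? {k = k} ℕ._≟_ a b) (C (2 + N) k))
    ≡ length (filter (related? ℕ._≟_ Fin.zero (Fin.suc Fin.zero)) (C (2 + N) k))
count-balanced-normalise {k} {N} a b a<b = begin
  #balanced a b                                          ≡⟨ count-related-symPow {k = k} (transpose a 0F) ℕ._≟_ a b ⟩
  #balanced (PC.transpose a 0F a) (PC.transpose a 0F b)  ≡⟨ cong₂ #balanced (transpose-matchˡ a 0F) (transpose-other b≢a b≢0) ⟩
  #balanced 0F b                                         ≡⟨ count-related-symPow {k = k} (transpose b 1F) ℕ._≟_ 0F b ⟩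
  #balanced (PC.transpose b 1F 0F) (PC.transpose b 1F b) ≡⟨ cong₂ #balanced (transpose-other (b≢0 ∘ sym) λ ()) (transpose-matchˡ b 1F) ⟩
  #balanced 0F 1F                                        ∎
  where
  open ≡-Reasoning
  0F 1F : Fin (2 + N)
  0F = Fin.zero
  1F = Fin.suc Fin.zero
  #balanced : Fin (2 + N) → Fin (2 + N) → ℕ
  #balanced c d = length (filter (related? {k = k} ℕ._≟_ c d) (C (2 + N) k))
  b≢a : b ≢ a
  b≢a refl = <-irrefl refl a<b
  b≢0 : b ≢ 0F
  b≢0 refl = contradiction a<b λ ()

CsSymPow-transpose : (a b : Fin n) → CsSymPow (transpose a b) k 2 ≡ length (filter (related? _<?_ a b) (C n k))
CsSymPow-transpose {k = k} a b = begin
  length (filter (exactPeriod? _≟V_ (symPow (transpose a b) k) 2) (C _ k)) / 2 ≡⟨ cong (_/ 2) (count-exactPeriod2 {k = k} a b) ⟩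
  (G + G) / 2                                                                   ≡⟨ cong (λ m → (G + m) / 2) (+-identityʳ G) ⟨
  (2 * G) / 2                                                                   ≡⟨ cong (_/ 2) (*-comm 2 G) ⟩
  (G * 2) / 2                                                                   ≡⟨ m*n/n≡m G 2 ⟩
  G                                                                             ∎
  where
  open ≡-Reasoning
  G = length (filter (related? _<?_ a b) (C _ k))

count-C-by-balance : {N : ℕ} (a b : Fin (2 + N)) → a <F b →
  length (compositions (2 + N) k)
    ≡ length (twinCompositions N k) + (length (filter (related? _<?_ a b) (C (2 + N) k))
                                       + length (filter (related? _<?_ a b) (C (2 + N) k)))
count-C-by-balance {k} {N} a b a<b = begin
  length (compositions (2 + N) k)
    ≡⟨ count-C (2 + N) k ⟨
  length (filter U? (C (2 + N) k))
    ≡⟨ count-balanced-⊎-exactPeriod2 {k = k} a b ⟩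
  length (filter (related? ℕ._≟_ a b) (C (2 + N) k)) + length (filter (exactPeriod? _≟V_ (symPow (transpose a b) k) 2) (C (2 + N) k))
    ≡⟨ cong₂ _+_ (trans (count-balanced-normalise {k = k} a b a<b) (count-C-twinHeaded N k)) (count-exactPeriod2 {k = k} a b) ⟩
  length (twinCompositions N k) + (length (filter (related? _<?_ a b) (C (2 + N) k)) + length (filter (related? _<?_ a b) (C (2 + N) k)))
    ∎
  where open ≡-Reasoning

sumTo-binom≡length-twinCompositions : (N k : ℕ) →
  sumTo (k / 2) (λ ℓ → binom (+ (k ∸ 2 * ℓ + (2 + N)) -ℤ + 3) (k ∸ 2 * ℓ)) ≡ fromℕ (length (twinCompositions N k))
sumTo-binom≡length-twinCompositions N k =
  trans (sumTo-cong (k / 2) λ ℓ → binom-shifted-compositions N (k ∸ 2 * ℓ)) (sumTo-length-compositions N k)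

corollary3p3 : (n k : ℕ) → 2 ≤ n → 1 ≤ k → (a b : Fin n) → a <F b →
    (+ CsSymPow (transpose a b) k 2) /ℚ 1
    ≡ ½ *ℚ (binom (+ (n + k ∸ 1)) (n ∸ 1)
    - sumTo (k / 2) (λ ℓ → binom (+ (k ∸ 2 * ℓ + n) -ℤ + 3) (k ∸ 2 * ℓ)))
corollary3p3 (suc zero)    _ (s≤s ()) _ _ _ _
corollary3p3 (suc (suc N)) k _ _ a b a<b = begin
  fromℕ (CsSymPow (transpose a b) k 2)
    ≡⟨ cong fromℕ (CsSymPow-transpose {k = k} a b) ⟩
  fromℕ G
    ≡⟨ fromℕ-half-difference F G ⟩
  ½ *ℚ (fromℕ (F + (G + G)) - fromℕ F)
    ≡⟨ cong (λ x → ½ *ℚ (fromℕ x - fromℕ F)) (count-C-by-balance {k = k} a b a<b) ⟨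
  ½ *ℚ (fromℕ (length (compositions (2 + N) k)) - fromℕ F)
    ≡⟨ cong₂ (λ x y → ½ *ℚ (x - y)) (binom-sym-compositions (suc N) k) (sumTo-binom≡length-twinCompositions N k) ⟨
  ½ *ℚ (binom (+ (suc N + k)) (suc N) - sumTo (k / 2) (λ ℓ → binom (+ (k ∸ 2 * ℓ + (2 + N)) -ℤ + 3) (k ∸ 2 * ℓ)))
    ∎
  where
  open ≡-Reasoning
  G = length (filter (related? _<?_ a b) (C (2 + N) k))
  F = length (twinCompositions N k)
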